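{- Every caterpillar is a proper max-point-tolerance graph.
   Context: A caterpillar is a tree containing a path $s_1,\dots,s_k$ (the spine) such that every vertex of the tree is at distance at most one from the spine. $G=(V,E)$ (finite, simple, undirected) is a max-point-tolerance graph (MPTG) if each vertex $u$ can be assigned a pair $(I_u,p_u)$, with $I_u$ a closed bounded real interval and $p_u\in I_u$, such that for distinct $u,v$, $uv\in E$ iff $\{p_u,p_v\}\subseteq I_u\cap I_v$. It is a proper MPTG if it has such a representation in which no interval properly contains another. -}

module Defs where

open import Data.Nat using (ℕ; suc; _+_)
open import Data.Fin using (Fin; zero; suc; inject₁; fromℕ)
open import Data.Bool using (Bool; true; false)
open import Data.Rational using (ℚ; _≤_)
open import Data.Product using (Σ; _×_; ∃; ∃-syntax; _,_)
open import Data.Sum using (_⊎_)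
open import Data.Empty using (⊥)
open import Relation.Nullary using (¬_)
open import Relation.Binary.PropositionalEquality using (_≡_; _≢_)
open import Function.Definitions using (Injective)

record Graph (n : ℕ) : Set where
  field
    adj   : Fin n → Fin n → Bool
    sym   : ∀ u v → adj u v ≡ adj v u
    irrefl : ∀ u → adj u u ≡ false

open Graph public

Edge : ∀ {n} → Graph n → Fin n → Fin n → Set
Edge G u v = adj G u v ≡ true

record Walk {n} (G : Graph n) (u v : Fin n) : Set where
  field
    len   : ℕ
    vert  : Fin (suc len) → Fin n
    start : vert zero ≡ u
    end   : vert (fromℕ len) ≡ v
    steps : ∀ (i : Fin len) → Edge G (vert (inject₁ i)) (vert (suc i))

Connected : ∀ {n} → Graph n → Set
Connected G = ∀ u v → Walk G u v

record Cycle {n} (G : Graph n) : Set where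
  field
    len    : ℕ
    vert   : Fin (suc (suc (suc len))) → Fin n
    inj    : Injective _≡_ _≡_ vert
    steps  : ∀ (i : Fin (suc (suc len))) → Edge G (vert (inject₁ i)) (vert (suc i))
    closes : Edge G (vert (fromℕ (suc (suc len)))) (vert zero)

Acyclic : ∀ {n} → Graph n → Set
Acyclic G = ¬ Cycle G

IsTree : ∀ {n} → Graph n → Set
IsTree G = Connected G × Acyclic G

record PathIn {n} (G : Graph n) : Set where
  field
    len   : ℕ
    vert  : Fin (suc len) → Fin n
    inj   : Injective _≡_ _≡_ vert
    steps : ∀ (i : Fin len) → Edge G (vert (inject₁ i)) (vert (suc i))

Dominates : ∀ {n} (G : Graph n) → PathIn G → Set
Dominates {n} G P = ∀ (v : Fin n) → ∃[ i ] (v ≡ PathIn.vert P i ⊎ Edge G v (PathIn.vert P i))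

IsCaterpillar : ∀ {n} → Graph n → Set
IsCaterpillar G = IsTree G × Σ (PathIn G) (Dominates G)

record Interval : Set where
  constructor [_,_]⟨_⟩
  field
    lo hi : ℚ
    lo≤hi : lo ≤ hi

_∈I_ : ℚ → Interval → Set
x ∈I I = Interval.lo I ≤ x × x ≤ Interval.hi I

_∈∩_,_ : ℚ → Interval → Interval → Set
x ∈∩ I , J = x ∈I I × x ∈I J

_⊆I_ : Interval → Interval → Set
I ⊆I J = ∀ x → x ∈I I → x ∈I J

_⊋I_ : Interval → Interval → Set
I ⊋I J = (J ⊆I I) × ¬ (I ⊆I J)

record MPTRep {n} (G : Graph n) : Set where
  field
    I   : Fin n → Interval
    p   : Fin n → ℚ
    p∈I : ∀ u → p u ∈I I u
    rep : ∀ u v → u ≢ v →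
          (Edge G u v → (p u ∈∩ I u , I v) × (p v ∈∩ I u , I v))
        × ((p u ∈∩ I u , I v) × (p v ∈∩ I u , I v) → Edge G u v)

IsProper : ∀ {n} {G : Graph n} → MPTRep G → Set
IsProper R = ∀ u v → ¬ (MPTRep.I R u ⊋I MPTRep.I R v)

IsProperMPTG : ∀ {n} → Graph n → Set
IsProperMPTG G = Σ (MPTRep G) IsProper

-- Number the spine s₀, …, s_L and give the spine vertex sᵢ the interval [i+1, i+3] with
-- point i+2, and a vertex v off the spine, attached to sᵢ, the interval [i, i+2] with point
-- i+2, everything except the spine shifted right by ε·(1 + v) for a small ε.  Acyclicity
-- says that the edges are then exactly those between consecutive spine vertices and those
-- between a vertex off the spine and its (unique) anchor, which is precisely when the two
-- points lie in both intervals; the shifts keep leaves with the same anchor apart.  All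
-- intervals have length 2, so none properly contains another.

module Submission where

open import Defs hiding (sym)
open import Data.Nat using (ℕ; zero; suc; _+_; _*_; _⊓_; _≤_; _<_; z≤n; s≤s; z<s)
open import Data.Nat.Properties hiding (_≟_)
open import Data.Fin using (Fin; zero; suc; toℕ; fromℕ<; inject₁)
open import Data.Fin.Properties
  using (toℕ-injective; toℕ<n; toℕ≤pred[n]; toℕ-inject₁; toℕ-fromℕ; toℕ-fromℕ<; any?; _≟_)
open import Data.Rational as ℚ using (ℚ; *≤*)
open import Data.Rational.Literals using (fromℤ)
import Data.Integer as ℤ
import Data.Integer.Properties as ℤ
open import Data.Product using (_×_; _,_; proj₁; proj₂; ∃; swap)
open import Data.Product using () renaming (map to ×-map)
open import Data.Sum using (_⊎_; inj₁; inj₂)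
import Data.Sum
open import Data.Empty using (⊥; ⊥-elim)
open import Relation.Nullary using (¬_; yes; no)
open import Relation.Binary using (tri<; tri≈; tri>)
open import Relation.Binary.PropositionalEquality
open import Function using (_∘_)
open import Function.Definitions using (Injective)

fromℕ : ℕ → ℚ
fromℕ k = fromℤ (ℤ.+ k)

fromℕ-mono-≤ : ∀ {a b} → a ≤ b → fromℕ a ℚ.≤ fromℕ b
fromℕ-mono-≤ {a} {b} a≤b =
  *≤* (subst₂ ℤ._≤_ (sym (ℤ.*-identityʳ (ℤ.+ a))) (sym (ℤ.*-identityʳ (ℤ.+ b))) (ℤ.+≤+ a≤b))

fromℕ-cancel-≤ : ∀ {a b} → fromℕ a ℚ.≤ fromℕ b → a ≤ b
fromℕ-cancel-≤ {a} {b} (*≤* a≤b) =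
  ℤ.drop‿+≤+ (subst₂ ℤ._≤_ (ℤ.*-identityʳ (ℤ.+ a)) (ℤ.*-identityʳ (ℤ.+ b)) a≤b)

natInterval : (l h : ℕ) → l ≤ h → Interval
natInterval l h l≤h = [ fromℕ l , fromℕ h ]⟨ fromℕ-mono-≤ l≤h ⟩

∈-natInterval : ∀ {l h x} (l≤h : l ≤ h) → l ≤ x × x ≤ h → fromℕ x ∈I natInterval l h l≤h
∈-natInterval _ = ×-map fromℕ-mono-≤ fromℕ-mono-≤

∈-natInterval⁻ : ∀ {l h x} (l≤h : l ≤ h) → fromℕ x ∈I natInterval l h l≤h → l ≤ x × x ≤ h
∈-natInterval⁻ _ = ×-map fromℕ-cancel-≤ fromℕ-cancel-≤

natInterval-¬⊋ : ∀ {l h l′ h′ w} (l≤h : l ≤ h) (l′≤h′ : l′ ≤ h′) → h ≡ l + w → h′ ≡ l′ + w →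
                 ¬ (natInterval l h l≤h ⊋I natInterval l′ h′ l′≤h′)
natInterval-¬⊋ {l} {h} {l′} {h′} {w} l≤h l′≤h′ h≡l+w h′≡l′+w (J⊆I , I⊈J) =
  I⊈J λ x → ×-map (subst (ℚ._≤ x) (cong fromℕ l≡l′)) (subst (x ℚ.≤_) (cong fromℕ h≡h′))
  where
  l≤l′ : l ≤ l′
  l≤l′ = proj₁ (∈-natInterval⁻ l≤h (J⊆I _ (∈-natInterval l′≤h′ (≤-refl , l′≤h′))))
  h′≤h : h′ ≤ h
  h′≤h = proj₂ (∈-natInterval⁻ l≤h (J⊆I _ (∈-natInterval l′≤h′ (l′≤h′ , ≤-refl))))
  l≡l′ : l ≡ l′
  l≡l′ = ≤-antisym l≤l′ (+-cancelʳ-≤ w l′ l (subst₂ _≤_ h′≡l′+w h≡l+w h′≤h))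
  h≡h′ : h ≡ h′
  h≡h′ = trans h≡l+w (trans (cong (_+ w) l≡l′) (sym h′≡l′+w))

-- (x , o) ↦ N x + o embeds ℕ × Fin N, ordered lexicographically, into ℕ.
opaque
  ⟪_,_⟫ : ∀ {N} → ℕ → Fin N → ℕ
  ⟪_,_⟫ {N} x o = N * x + toℕ o

  ⟪⟫-mono-< : ∀ {N x y} {o o′ : Fin N} → x < y → ⟪ x , o ⟫ < ⟪ y , o′ ⟫
  ⟪⟫-mono-< {N} {x} {y} {o} {o′} x<y = begin-strict
    N * x + toℕ o   <⟨ +-monoʳ-< (N * x) (toℕ<n o) ⟩
    N * x + N       ≡⟨ +-comm (N * x) N ⟩
    N + N * x       ≡⟨ *-suc N x ⟨
    N * suc x       ≤⟨ *-monoʳ-≤ N x<y ⟩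
    N * y           ≤⟨ m≤m+n (N * y) (toℕ o′) ⟩
    N * y + toℕ o′  ∎
    where open ≤-Reasoning

  ⟪⟫-monoʳ-≤ : ∀ {N} x {o o′ : Fin N} → toℕ o ≤ toℕ o′ → ⟪ x , o ⟫ ≤ ⟪ x , o′ ⟫
  ⟪⟫-monoʳ-≤ {N} x = +-monoʳ-≤ (N * x)

  ⟪⟫-cancel-≤ : ∀ {N x y} {o o′ : Fin N} → ⟪ x , o ⟫ ≤ ⟪ y , o′ ⟫ → x < y ⊎ (x ≡ y × toℕ o ≤ toℕ o′)
  ⟪⟫-cancel-≤ {N} {x} {y} {o} {o′} le with <-cmp x y
  ... | tri< x<y _ _ = inj₁ x<y
  ... | tri≈ _ refl _ = inj₂ (refl , +-cancelˡ-≤ (N * x) (toℕ o) (toℕ o′) le)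
  ... | tri> _ _ y<x = ⊥-elim (<⇒≱ (⟪⟫-mono-< {o = o′} {o} y<x) le)

  ⟪⟫-injective : ∀ {N x y} {o o′ : Fin N} → ⟪ x , o ⟫ ≡ ⟪ y , o′ ⟫ → x ≡ y × o ≡ o′
  ⟪⟫-injective {N} {x} {y} {o} {o′} eq with <-cmp x y
  ... | tri< x<y _ _ = ⊥-elim (<⇒≢ (⟪⟫-mono-< {o = o} {o′} x<y) eq)
  ... | tri≈ _ refl _ = refl , toℕ-injective (+-cancelˡ-≡ (N * x) (toℕ o) (toℕ o′) eq)
  ... | tri> _ _ y<x = ⊥-elim (<⇒≢ (⟪⟫-mono-< {o = o′} {o} y<x) (sym eq))

  ⟪⟫-+2 : ∀ {N} x (o : Fin N) → ⟪ x , o ⟫ + (N + N) ≡ ⟪ 2 + x , o ⟫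
  ⟪⟫-+2 {N} x o = begin
    N * x + toℕ o + (N + N)   ≡⟨ +-comm (N * x + toℕ o) (N + N) ⟩
    N + N + (N * x + toℕ o)   ≡⟨ +-assoc (N + N) (N * x) (toℕ o) ⟨
    N + N + N * x + toℕ o     ≡⟨ cong (_+ toℕ o) (+-assoc N N (N * x)) ⟩
    N + (N + N * x) + toℕ o   ≡⟨ cong (λ z → N + z + toℕ o) (*-suc N x) ⟨
    N + N * suc x + toℕ o     ≡⟨ cong (_+ toℕ o) (*-suc N (suc x)) ⟨
    N * (2 + x) + toℕ o       ∎
    where open ≡-Reasoning

⟪⟫-cancelˡ-≤ : ∀ {N x y} {o o′ : Fin N} → ⟪ x , o ⟫ ≤ ⟪ y , o′ ⟫ → x ≤ y
⟪⟫-cancelˡ-≤ le with ⟪⟫-cancel-≤ le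
... | inj₁ x<y = <⇒≤ x<y
... | inj₂ (refl , _) = ≤-refl

⟪⟫-cancel-< : ∀ {N x y} {o o′ : Fin N} → toℕ o′ < toℕ o → ⟪ x , o ⟫ ≤ ⟪ y , o′ ⟫ → x < y
⟪⟫-cancel-< o′<o le with ⟪⟫-cancel-≤ le
... | inj₁ x<y = x<y
... | inj₂ (_ , o≤o′) = ⊥-elim (<⇒≱ o′<o o≤o′)

data Slot (n : ℕ) : Set where
  spineAt : ℕ → Slot n
  leafAt  : ℕ → Fin n → Slot n

Adjacent : ∀ {n} → Slot n → Slot n → Set
Adjacent (spineAt i)  (spineAt j)  = suc i ≡ j ⊎ suc j ≡ i
Adjacent (spineAt i)  (leafAt j _) = i ≡ j
Adjacent (leafAt i _) (spineAt j)  = i ≡ j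
Adjacent (leafAt _ _) (leafAt _ _) = ⊥

module _ {n : ℕ} where

  index : Slot n → ℕ
  index (spineAt i)  = i
  index (leafAt i _) = i

  lowerIndex : Slot n → ℕ
  lowerIndex (spineAt i)  = suc i
  lowerIndex (leafAt i _) = i

  offset : Slot n → Fin (suc n)
  offset (spineAt _)  = zero
  offset (leafAt _ v) = suc v

  lower upper point : Slot n → ℕ
  lower a = ⟪ lowerIndex a , offset a ⟫
  upper a = ⟪ 2 + lowerIndex a , offset a ⟫
  point a = ⟪ 2 + index a , offset a ⟫

  _∈[_] : ℕ → Slot n → Set
  x ∈[ a ] = lower a ≤ x × x ≤ upper a

  Tolerant : Slot n → Slot n → Set
  Tolerant a b = point a ∈[ b ] × point b ∈[ a ]

  point∈[_] : (a : Slot n) → point a ∈[ a ]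
  point∈[ spineAt i ]  = <⇒≤ (⟪⟫-mono-< (n<1+n (suc i)))
                       , <⇒≤ (⟪⟫-mono-< (n<1+n (2 + i)))
  point∈[ leafAt i v ] = <⇒≤ (⟪⟫-mono-< (s≤s (n≤1+n i))) , ≤-refl

  lower≤upper : (a : Slot n) → lower a ≤ upper a
  lower≤upper a = ≤-trans (proj₁ point∈[ a ]) (proj₂ point∈[ a ])

  adjacent⇒tolerant : ∀ a b → Adjacent a b → Tolerant a b
  adjacent⇒tolerant (spineAt i)  (spineAt _)  (inj₁ refl) =
      (≤-refl , <⇒≤ (⟪⟫-mono-< (≤-trans (n<1+n (2 + i)) (n≤1+n (3 + i)))))
    , (<⇒≤ (⟪⟫-mono-< (s≤s (n≤1+n (suc i)))) , ≤-refl)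
  adjacent⇒tolerant (spineAt _)  (spineAt j)  (inj₂ refl) =
    swap (adjacent⇒tolerant (spineAt j) (spineAt (suc j)) (inj₁ refl))
  adjacent⇒tolerant (spineAt i)  (leafAt _ v) refl =
      (<⇒≤ (⟪⟫-mono-< (s≤s (n≤1+n i))) , ⟪⟫-monoʳ-≤ (2 + i) z≤n)
    , (<⇒≤ (⟪⟫-mono-< (n<1+n (suc i))) , <⇒≤ (⟪⟫-mono-< (n<1+n (2 + i))))
  adjacent⇒tolerant (leafAt i v) (spineAt _)  refl =
    swap (adjacent⇒tolerant (spineAt i) (leafAt i v) refl)

  tolerant⇒adjacent : ∀ a b → a ≢ b → Tolerant a b → Adjacent a b
  tolerant⇒adjacent (spineAt i) (spineAt j) a≢b ((_ , a≤b) , (_ , b≤a))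
    with <-cmp i j
  ... | tri< i<j _ _ = inj₁ (≤-antisym i<j (≤-pred (≤-pred (⟪⟫-cancelˡ-≤ b≤a))))
  ... | tri≈ _ refl _ = ⊥-elim (a≢b refl)
  ... | tri> _ _ j<i = inj₂ (≤-antisym j<i (≤-pred (≤-pred (⟪⟫-cancelˡ-≤ a≤b))))
  tolerant⇒adjacent (spineAt i) (leafAt j v) _ ((_ , a≤b) , (_ , b≤a)) =
    ≤-antisym (≤-pred (≤-pred (⟪⟫-cancelˡ-≤ a≤b)))
              (≤-pred (≤-pred (≤-pred (⟪⟫-cancel-< z<s b≤a))))
  tolerant⇒adjacent (leafAt i v) (spineAt j) a≢b t =
    sym (tolerant⇒adjacent (spineAt j) (leafAt i v) (a≢b ∘ sym) (swap t))
  tolerant⇒adjacent (leafAt i v) (leafAt j w) a≢b ((_ , a≤b) , (_ , b≤a))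
    with ⟪⟫-injective (≤-antisym a≤b b≤a)
  ... | refl , refl = a≢b refl

  interval : Slot n → Interval
  interval a = natInterval (lower a) (upper a) (lower≤upper a)

  ∈-interval : ∀ {x} a → x ∈[ a ] → fromℕ x ∈I interval a
  ∈-interval a = ∈-natInterval (lower≤upper a)

  ∈-interval⁻ : ∀ {x} a → fromℕ x ∈I interval a → x ∈[ a ]
  ∈-interval⁻ a = ∈-natInterval⁻ (lower≤upper a)

  interval-¬⊋ : ∀ a b → ¬ (interval a ⊋I interval b)
  interval-¬⊋ a b = natInterval-¬⊋ (lower≤upper a) (lower≤upper b)
    (sym (⟪⟫-+2 (lowerIndex a) (offset a))) (sym (⟪⟫-+2 (lowerIndex b) (offset b)))

record SlotEmbedding {n} (G : Graph n) : Set where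
  field
    slot           : Fin n → Slot n
    slot-injective : Injective _≡_ _≡_ slot
    edge⇒adjacent  : ∀ {u v} → Edge G u v → Adjacent (slot u) (slot v)
    adjacent⇒edge  : ∀ {u v} → Adjacent (slot u) (slot v) → Edge G u v

slotEmbedding⇒properMPTG : ∀ {n} {G : Graph n} → SlotEmbedding G → IsProperMPTG G
slotEmbedding⇒properMPTG {n} {G} E = representation , λ u v → interval-¬⊋ (slot u) (slot v)
  where
  open SlotEmbedding E

  I : Fin n → Interval
  I = interval ∘ slot

  p : Fin n → ℚ
  p = fromℕ ∘ point ∘ slot

  p∈I : ∀ u → p u ∈I I u
  p∈I u = ∈-interval (slot u) point∈[ slot u ]

  edge⇒tolerance : ∀ {u v} → Edge G u v → (p u ∈∩ I u , I v) × (p v ∈∩ I u , I v)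
  edge⇒tolerance {u} {v} e with adjacent⇒tolerant (slot u) (slot v) (edge⇒adjacent e)
  ... | pu∈v , pv∈u = (p∈I u , ∈-interval (slot v) pu∈v) , (∈-interval (slot u) pv∈u , p∈I v)

  tolerance⇒edge : ∀ {u v} → u ≢ v → (p u ∈∩ I u , I v) × (p v ∈∩ I u , I v) → Edge G u v
  tolerance⇒edge {u} {v} u≢v ((_ , pu∈v) , (pv∈u , _)) = adjacent⇒edge
    (tolerant⇒adjacent (slot u) (slot v) (u≢v ∘ slot-injective)
      (∈-interval⁻ (slot v) pu∈v , ∈-interval⁻ (slot u) pv∈u))

  representation : MPTRep G
  representation = record
    { I   = I
    ; p   = p
    ; p∈I = p∈I
    ; rep = λ u v u≢v → edge⇒tolerance , tolerance⇒edge u≢v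
    }

m≤n⇒∃[o]o+m≡n : ∀ {m n} → m ≤ n → ∃ λ o → o + m ≡ n
m≤n⇒∃[o]o+m≡n m≤n = _ , m∸n+n≡m m≤n

wlog-≤ : ∀ {p} (P : ℕ → ℕ → Set p) → (∀ {i j} → P i j → P j i) → (∀ {i} o → P i (o + i)) →
         ∀ i j → P i j
wlog-≤ P P-sym ordered i j with ≤-total i j
... | inj₁ i≤j with m≤n⇒∃[o]o+m≡n i≤j
...   | o , refl = ordered o
wlog-≤ P P-sym ordered i j | inj₂ j≤i with m≤n⇒∃[o]o+m≡n j≤i
...   | o , refl = P-sym (ordered o)

_◂_ : ∀ {a} {A : Set a} → A → (ℕ → A) → ℕ → A
(x ◂ c) zero    = x
(x ◂ c) (suc i) = c i

module _ {n} (G : Graph n) where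

  edge-sym : ∀ {u v} → Edge G u v → Edge G v u
  edge-sym {u} {v} = trans (Graph.sym G v u)

  edge⇒≢ : ∀ {u v} → Edge G u v → u ≢ v
  edge⇒≢ {u} e refl with () ← trans (sym (irrefl G u)) e

record IsPath {n} (G : Graph n) (m : ℕ) (c : ℕ → Fin n) : Set where
  field
    injective : ∀ {i j} → i ≤ m → j ≤ m → c i ≡ c j → i ≡ j
    steps     : ∀ {i} → i < m → Edge G (c i) (c (suc i))

module _ {n} {G : Graph n} where

  IsPath-drop : ∀ {l m a c} → m + a ≤ l → IsPath G l c → IsPath G m (c ∘ (_+ a))
  IsPath-drop {l} {m} {a} m+a≤l path = record
    { injective = λ i≤m j≤m eq → +-cancelʳ-≡ a _ _ (injective (within i≤m) (within j≤m) eq)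
    ; steps     = λ i<m → steps (within i<m)
    }
    where
    open IsPath path
    within : ∀ {i} → i ≤ m → i + a ≤ l
    within i≤m = ≤-trans (+-monoˡ-≤ a i≤m) m+a≤l

  IsPath-◂ : ∀ {m c v} → (∀ {i} → i ≤ m → c i ≢ v) → Edge G v (c 0) →
             IsPath G m c → IsPath G (suc m) (v ◂ c)
  IsPath-◂ {m} {c} {v} avoids v~c₀ path = record { injective = injective′ ; steps = steps′ }
    where
    open IsPath path
    injective′ : ∀ {i j} → i ≤ suc m → j ≤ suc m → (v ◂ c) i ≡ (v ◂ c) j → i ≡ j
    injective′ {zero}  {zero}  _         _         _  = refl
    injective′ {zero}  {suc j} _         (s≤s j≤m) eq = ⊥-elim (avoids j≤m (sym eq))
    injective′ {suc i} {zero}  (s≤s i≤m) _         eq = ⊥-elim (avoids i≤m eq)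
    injective′ {suc i} {suc j} (s≤s i≤m) (s≤s j≤m) eq = cong suc (injective i≤m j≤m eq)
    steps′ : ∀ {i} → i < suc m → Edge G ((v ◂ c) i) ((v ◂ c) (suc i))
    steps′ {zero}  _         = v~c₀
    steps′ {suc i} (s≤s i<m) = steps i<m

  acyclic⇒no-closing-edge : Acyclic G → ∀ {m c} → IsPath G m c → 2 ≤ m → ¬ Edge G (c m) (c 0)
  acyclic⇒no-closing-edge acyclic {suc (suc m)} {c} path (s≤s (s≤s _)) closing = acyclic record
    { len    = m
    ; vert   = c ∘ toℕ
    ; inj    = λ {i} {j} eq → toℕ-injective (injective (toℕ≤pred[n] i) (toℕ≤pred[n] j) eq)
    ; steps  = λ i →
        subst (λ k → Edge G (c k) (c (suc (toℕ i)))) (sym (toℕ-inject₁ i)) (steps (toℕ<n i))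
    ; closes = subst (λ k → Edge G (c k) (c 0)) (sym (toℕ-fromℕ (suc (suc m)))) closing
    }
    where open IsPath path

module Caterpillar {n} {G : Graph n} (acyclic : Acyclic G) (P : PathIn G) (dominates : Dominates G P)
  where

  open PathIn P using () renaming (len to L; vert to s)

  -- clamp saturates at L, so spine k is junk (the last spine vertex) for k > L.
  clamp : ℕ → Fin (suc L)
  clamp k = fromℕ< (s≤s (m⊓n≤n k L))

  toℕ-clamp : ∀ {k} → k ≤ L → toℕ (clamp k) ≡ k
  toℕ-clamp k≤L = trans (toℕ-fromℕ< _) (m≤n⇒m⊓n≡m k≤L)

  spine : ℕ → Fin n
  spine = s ∘ clamp

  s≡spine : ∀ {k} (j : Fin (suc L)) → toℕ j ≡ k → s j ≡ spine k
  s≡spine j refl = cong s (toℕ-injective (sym (toℕ-clamp (toℕ≤pred[n] j))))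

  spine-isPath : IsPath G L spine
  spine-isPath = record
    { injective = λ i≤L j≤L eq →
        trans (sym (toℕ-clamp i≤L)) (trans (cong toℕ (PathIn.inj P eq)) (toℕ-clamp j≤L))
    ; steps     = λ {i} i<L → let j = fromℕ< i<L in
        subst₂ (Edge G) (s≡spine (inject₁ j) (trans (toℕ-inject₁ j) (toℕ-fromℕ< i<L)))
                        (s≡spine (suc j) (cong suc (toℕ-fromℕ< i<L)))
                        (PathIn.steps P j)
    }

  segment : ∀ {m a} → m + a ≤ L → IsPath G m (spine ∘ (_+ a))
  segment m+a≤L = IsPath-drop m+a≤L spine-isPath

  OffSpine : Fin n → Set
  OffSpine v = ∀ {k} → k ≤ L → spine k ≢ v

  avoids-segment : ∀ {v m a} → OffSpine v → m + a ≤ L → ∀ {i} → i ≤ m → spine (i + a) ≢ v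
  avoids-segment v-off m+a≤L i≤m = v-off (≤-trans (+-monoˡ-≤ _ i≤m) m+a≤L)

  spine-chordless : ∀ {i} m → 2 ≤ m → m + i ≤ L → ¬ Edge G (spine i) (spine (m + i))
  spine-chordless m 2≤m m+i≤L e =
    acyclic⇒no-closing-edge acyclic (segment {m} m+i≤L) 2≤m (edge-sym G e)

  offSpine-anchor-unique : ∀ {v} → OffSpine v → ∀ i j → i ≤ L → j ≤ L →
                           Edge G v (spine i) → Edge G v (spine j) → i ≡ j
  offSpine-anchor-unique {v} v-off =
    wlog-≤ Anchors (λ r j≤L i≤L v~j v~i → sym (r i≤L j≤L v~i v~j)) ordered
    where
    Anchors : ℕ → ℕ → Set
    Anchors i j = i ≤ L → j ≤ L → Edge G v (spine i) → Edge G v (spine j) → i ≡ j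
    ordered : ∀ {i} o → Anchors i (o + i)
    ordered zero    _ _   _   _   = refl
    ordered (suc o) _ j≤L v~i v~j = ⊥-elim (acyclic⇒no-closing-edge acyclic
      (IsPath-◂ (avoids-segment v-off j≤L) v~i (segment {suc o} j≤L))
      (s≤s (s≤s z≤n)) (edge-sym G v~j))

  offSpine-nonadjacent : ∀ {x y} → OffSpine x → OffSpine y → ∀ i j → i ≤ L → j ≤ L →
                         Edge G x (spine i) → Edge G y (spine j) → ¬ Edge G x y
  offSpine-nonadjacent x-off y-off i j = wlog-≤ Apart Apart-sym ordered i j x-off y-off
    where
    Apart : ℕ → ℕ → Set
    Apart i j = ∀ {x y} → OffSpine x → OffSpine y → i ≤ L → j ≤ L →
                Edge G x (spine i) → Edge G y (spine j) → ¬ Edge G x y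
    Apart-sym : ∀ {i j} → Apart i j → Apart j i
    Apart-sym r y-off x-off j≤L i≤L y~j x~i x~y = r x-off y-off i≤L j≤L x~i y~j (edge-sym G x~y)
    ordered : ∀ {i} o → Apart i (o + i)
    ordered {i} o {x} {y} x-off y-off _ j≤L x~i y~j x~y = acyclic⇒no-closing-edge acyclic
      (IsPath-◂ y-avoids (edge-sym G x~y)
        (IsPath-◂ (avoids-segment x-off j≤L) x~i (segment {o} j≤L)))
      (s≤s (s≤s z≤n)) (edge-sym G y~j)
      where
      y-avoids : ∀ {k} → k ≤ suc o → (x ◂ (spine ∘ (_+ i))) k ≢ y
      y-avoids {zero}  _         = edge⇒≢ G x~y
      y-avoids {suc k} (s≤s k≤o) = avoids-segment y-off j≤L k≤o

  spine-adjacent : ∀ i j → i ≤ L → j ≤ L → Edge G (spine i) (spine j) → suc i ≡ j ⊎ suc j ≡ i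
  spine-adjacent = wlog-≤ Neighbours
    (λ r j≤L i≤L e → Data.Sum.swap (r i≤L j≤L (edge-sym G e))) ordered
    where
    Neighbours : ℕ → ℕ → Set
    Neighbours i j = i ≤ L → j ≤ L → Edge G (spine i) (spine j) → suc i ≡ j ⊎ suc j ≡ i
    ordered : ∀ {i} o → Neighbours i (o + i)
    ordered zero          _ _   e = ⊥-elim (edge⇒≢ G e refl)
    ordered (suc zero)    _ _   _ = inj₁ refl
    ordered (suc (suc o)) _ j≤L e = ⊥-elim (spine-chordless (2 + o) (s≤s (s≤s z≤n)) j≤L e)

  data Position (v : Fin n) : Set where
    on-spine  : ∀ k → k ≤ L → spine k ≡ v → Position v
    off-spine : ∀ k → k ≤ L → Edge G v (spine k) → OffSpine v → Position v

  position : ∀ v → Position v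
  position v with any? (λ j → s j ≟ v)
  ... | yes (j , sj≡v) = on-spine (toℕ j) (toℕ≤pred[n] j) (trans (sym (s≡spine j refl)) sj≡v)
  ... | no v∉spine with dominates v
  ...   | j , inj₁ v≡sj = ⊥-elim (v∉spine (j , sym v≡sj))
  ...   | j , inj₂ v~sj = off-spine (toℕ j) (toℕ≤pred[n] j) (subst (Edge G v) (s≡spine j refl) v~sj)
      λ k≤L spine-k≡v → v∉spine (clamp _ , trans (s≡spine _ (toℕ-clamp k≤L)) spine-k≡v)

  slotAt : ∀ {v} → Position v → Slot n
  slotAt (on-spine k _ _)      = spineAt k
  slotAt {v} (off-spine k _ _ _) = leafAt k v

  slotAt-injective : ∀ {u v} (pu : Position u) (pv : Position v) → slotAt pu ≡ slotAt pv → u ≡ v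
  slotAt-injective (on-spine _ _ refl)  (on-spine _ _ refl)  refl = refl
  slotAt-injective (off-spine _ _ _ _)  (off-spine _ _ _ _)  refl = refl

  edge⇒adjacent : ∀ {u v} (pu : Position u) (pv : Position v) →
                  Edge G u v → Adjacent (slotAt pu) (slotAt pv)
  edge⇒adjacent (on-spine i i≤L refl) (on-spine j j≤L refl) e = spine-adjacent i j i≤L j≤L e
  edge⇒adjacent (on-spine i i≤L refl) (off-spine j j≤L v~j v-off) e =
    offSpine-anchor-unique v-off i j i≤L j≤L (edge-sym G e) v~j
  edge⇒adjacent (off-spine i i≤L u~i u-off) (on-spine j j≤L refl) e =
    offSpine-anchor-unique u-off i j i≤L j≤L u~i e
  edge⇒adjacent (off-spine i i≤L u~i u-off) (off-spine j j≤L v~j v-off) e =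
    offSpine-nonadjacent u-off v-off i j i≤L j≤L u~i v~j e

  adjacent⇒edge : ∀ {u v} (pu : Position u) (pv : Position v) →
                  Adjacent (slotAt pu) (slotAt pv) → Edge G u v
  adjacent⇒edge (on-spine _ _ refl)   (on-spine _ j≤L refl) (inj₁ refl) = IsPath.steps spine-isPath j≤L
  adjacent⇒edge (on-spine _ i≤L refl) (on-spine _ _ refl)   (inj₂ refl) =
    edge-sym G (IsPath.steps spine-isPath i≤L)
  adjacent⇒edge (on-spine _ _ refl)   (off-spine _ _ v~j _) refl        = edge-sym G v~j
  adjacent⇒edge (off-spine _ _ u~i _) (on-spine _ _ refl)   refl        = u~i

  slotEmbedding : SlotEmbedding G
  slotEmbedding = record
    { slot           = slotAt ∘ position
    ; slot-injective = λ {u} {v} → slotAt-injective (position u) (position v)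
    ; edge⇒adjacent  = λ {u} {v} → edge⇒adjacent (position u) (position v)
    ; adjacent⇒edge  = λ {u} {v} → adjacent⇒edge (position u) (position v)
    }

proposition3p4 : ∀ (n : ℕ) (G : Graph n) → IsCaterpillar G → IsProperMPTG G
proposition3p4 n G ((_ , acyclic) , (P , dominates)) =
  slotEmbedding⇒properMPTG (Caterpillar.slotEmbedding acyclic P dominates)
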